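{- Fix integers $m,l$ and letters $a<b$ in $[m]$. All primitive subword patterns $\tau\in[m]^l$ with first letter $\tau_1=a$ and last letter $\tau_l=b$ are in the same strong Wilf class: for any two such patterns $\tau,\tau'$ and all $k\ge1$, $n\ge0$, $r\ge0$, the number of words in $[k]^n$ containing $\tau$ exactly $r$ times equals the number containing $\tau'$ exactly $r$ times.
   Context: $[k]^n$ is the set of words of length $n$ over $\{1,\dots,k\}$. A subword pattern is a word $\tau\in[m]^l$ containing every letter of $[m]$. An occurrence of $\tau$ in $\sigma=\sigma_1\cdots\sigma_n$ is an index $i$ such that the consecutive factor $\sigma_i\cdots\sigma_{i+l-1}$ is order-isomorphic to $\tau$ (same relative order and same equalities among positions); "containing exactly $r$ times" means having exactly $r$ occurrences. A subword pattern is primitive if any two distinct occurrences of it (in any word) overlap in at most one letter. -}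

module Defs where

open import Data.Nat as ℕ using (ℕ; zero; suc; _+_; _≤_; _<_; _≤?_)
open import Data.Nat.Properties using (+-monoʳ-<; <-≤-trans)
open import Data.Fin as Fin using (Fin; toℕ; fromℕ<)
open import Data.Fin.Properties as FinP using (toℕ<n; all?)
open import Data.Vec as Vec using (Vec; []; _∷_; lookup)
open import Data.List as List using (List; []; _∷_; [_]; concatMap; map; filter; length; upTo)
open import Data.Product using (Σ; _×_; _,_)
open import Function.Bundles using (_⇔_)
open import Relation.Binary.PropositionalEquality using (_≡_)
open import Relation.Nullary using (Dec; yes; no; _×-dec_)
open import Relation.Nullary.Decidable using (_→-dec_)
open import Function.Bundles using (mk⇔; Equivalence)
open import Relation.Unary using (Decidable)

-- A word of length n over [k] = {1..k}, encoded with letters Fin k.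
Word : ℕ → ℕ → Set
Word k n = Fin n → Fin k

pos : ∀ {n l} (i : ℕ) → i + l ≤ n → Fin l → Fin n
pos {n} {l} i h p = fromℕ< (<-≤-trans (+-monoʳ-< i (toℕ<n p)) h)

OrderIso : ∀ {k m l} → (Fin l → Fin k) → (Fin l → Fin m) → Set
OrderIso {l = l} u τ =
  (p q : Fin l) → ((u p Fin.< u q) ⇔ (τ p Fin.< τ q)) × ((u p ≡ u q) ⇔ (τ p ≡ τ q))

OccursAt : ∀ {k n m l} → Word k n → (Fin l → Fin m) → ℕ → Set
OccursAt {n = n} {l = l} σ τ i = Σ (i + l ≤ n) λ h → OrderIso (λ p → σ (pos i h p)) τ

infixr 2 _⇔-dec_
_⇔-dec_ : ∀ {A B : Set} → Dec A → Dec B → Dec (A ⇔ B)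
a ⇔-dec b with a →-dec b | b →-dec a
... | yes f | yes g = yes (mk⇔ f g)
... | no ¬f | _ = no λ e → ¬f (Equivalence.to e)
... | _ | no ¬g = no λ e → ¬g (Equivalence.from e)

orderIso? : ∀ {k m l} (u : Fin l → Fin k) (τ : Fin l → Fin m) → Dec (OrderIso u τ)
orderIso? u τ = all? λ p → all? λ q →
  ((u p Fin.<? u q) ⇔-dec (τ p Fin.<? τ q)) ×-dec ((u p FinP.≟ u q) ⇔-dec (τ p FinP.≟ τ q))

occursAt? : ∀ {k n m l} (σ : Word k n) (τ : Fin l → Fin m) → Decidable (OccursAt σ τ)
occursAt? {n = n} {l = l} σ τ i with i + l ≤? n
... | no ¬h = no λ { (h , _) → ¬h h }
... | yes h with orderIso? (λ p → σ (pos i h p)) τ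
...   | yes iso = yes (h , iso)
...   | no ¬iso = no λ { (h' , iso) → ¬iso (subst' h' h iso) }
  where
  open import Data.Nat.Properties using (≤-irrelevant)
  open import Relation.Binary.PropositionalEquality using (subst)
  subst' : (h' h : i + l ≤ n) → OrderIso (λ p → σ (pos i h' p)) τ → OrderIso (λ p → σ (pos i h p)) τ
  subst' h' h x = subst (λ e → OrderIso (λ p → σ (pos i e p)) τ) (≤-irrelevant h' h) x

occurrences : ∀ {k n m l} → Word k n → (Fin l → Fin m) → ℕ
occurrences {n = n} σ τ = length (filter (occursAt? σ τ) (upTo n))

allVecs : (k n : ℕ) → List (Vec (Fin k) n)
allVecs k zero = [ [] ]
allVecs k (suc n) = concatMap (λ x → map (x ∷_) (allVecs k n)) (List.allFin k)

countExactly : ∀ {m l} (k n : ℕ) → (Fin l → Fin m) → ℕ → ℕ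
countExactly k n τ r =
  length (filter (λ v → occurrences (lookup v) τ ℕ.≟ r) (allVecs k n))

ContainsAllLetters : ∀ {m l} → (Fin l → Fin m) → Set
ContainsAllLetters {m} {l} τ = (c : Fin m) → Σ (Fin l) λ p → τ p ≡ c

-- Primitive: any two distinct occurrences (in any word) overlap in at most
-- one letter; for occurrences i < j of a length-l pattern the overlap is
-- {j, …, i+l-1}, so this means i + l ≤ j + 1.
Primitive : ∀ {m l} → (Fin l → Fin m) → Set
Primitive {l = l} τ = (k n : ℕ) (σ : Word k n) (i j : ℕ) →
  OccursAt σ τ i → OccursAt σ τ j → i < j → i + l ≤ j + 1

module Submission where

-- For a set S of positions, let A_S(τ) be the number of words in which every i ∈ S is an
-- occurrence of τ. Counting pairs (σ, S) with |S| = s in two ways, Σ_σ C(occ_τ(σ), s) =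
-- Σ_{|S| = s} A_S(τ); these binomial moments determine how many words contain τ exactly r
-- times, so it suffices to show A_S(τ) = A_S(τ′) for every S.
-- By primitivity the windows of length l + 1 starting in S overlap in at most one letter, so
-- their interiors are disjoint. As τ uses every letter, τ′ = τ ∘ g for some g, and reading the
-- interior of every window through g turns a word counted by A_S(τ) into one counted by A_S(τ′);
-- the first and last letters, shared by τ and τ′, stay put. The analogous map for τ = τ′ ∘ g′
-- undoes it, so A_S(τ) ≤ A_S(τ′), and the same argument with τ and τ′ exchanged gives equality.

open import Defs

module Counting where

  open import Data.Empty using (⊥-elim)
  open import Data.List using (List; []; _∷_; _++_; map; filter; length)
  open import Data.List.Membership.Propositional using (_∈_)
  open import Data.List.Membership.Propositional.Properties using (∈-∃++; ∈-filter⁺; ∈-filter⁻)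
  open import Data.List.Properties using (filter-++; filter-≐; filter-accept; filter-reject; filter-none; length-++)
  open import Data.List.Relation.Unary.All as All using ()
  open import Data.List.Relation.Unary.Any using (here; there)
  open import Data.List.Relation.Unary.Unique.Propositional using (Unique; []; _∷_)
  import Data.List.Relation.Unary.Unique.Propositional.Properties as Unique
  open import Data.Nat using (ℕ; suc; _+_; _≤_; z≤n; s≤s)
  open import Data.Nat.ListAction using (sum)
  open import Data.Nat.Properties using (+-suc; ≤-trans; ≤-reflexive; +-commutativeSemigroup)
  open import Algebra.Properties.CommutativeSemigroup +-commutativeSemigroup using (x∙yz≈y∙xz)
  open import Data.Product using (_,_; proj₂)
  open import Function using (_∘_)
  open import Relation.Binary.PropositionalEquality using (_≡_; _≢_; refl; sym; trans; cong)
  open import Relation.Nullary using (¬_; Dec; yes; no)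
  open import Relation.Unary using (Decidable; _⊆_; _≐_)

  count : {A : Set} {P : A → Set} → Decidable P → List A → ℕ
  count P? xs = length (filter P? xs)

  module _ {A : Set} {P : A → Set} (P? : Decidable P) where

    count-map : {B : Set} (f : B → A) (xs : List B) → count P? (map f xs) ≡ count (P? ∘ f) xs
    count-map f [] = refl
    count-map f (x ∷ xs) with P? (f x)
    ... | yes _ = cong suc (count-map f xs)
    ... | no _ = count-map f xs

    count-accept : ∀ {x xs} → P x → count P? (x ∷ xs) ≡ suc (count P? xs)
    count-accept = cong length ∘ filter-accept P?

    count-reject : ∀ {x xs} → ¬ P x → count P? (x ∷ xs) ≡ count P? xs
    count-reject = cong length ∘ filter-reject P?

    count-++ : ∀ xs ys → count P? (xs ++ ys) ≡ count P? xs + count P? ys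
    count-++ xs ys = trans (cong length (filter-++ P? xs ys)) (length-++ (filter P? xs))

    count-none : (∀ {x} → ¬ P x) → ∀ xs → count P? xs ≡ 0
    count-none ¬P xs = cong length (filter-none P? {xs} (All.tabulate λ _ → ¬P))

    count-filter-⊆ : {Q : A → Set} (Q? : Decidable Q) → P ⊆ Q → ∀ xs → count P? (filter Q? xs) ≡ count P? xs
    count-filter-⊆ Q? P⊆Q [] = refl
    count-filter-⊆ Q? P⊆Q (x ∷ xs) with Q? x
    ... | no ¬Qx = trans (count-filter-⊆ Q? P⊆Q xs) (sym (count-reject {xs = xs} (¬Qx ∘ P⊆Q)))
    ... | yes _ with P? x
    ...   | yes _ = cong suc (count-filter-⊆ Q? P⊆Q xs)
    ...   | no _ = count-filter-⊆ Q? P⊆Q xs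

  module _ {A B : Set} {R : A → B → Set} (R? : ∀ x y → Dec (R x y)) where

    sum-count-swap : ∀ xs ys →
      sum (map (λ x → count (R? x) ys) xs) ≡ sum (map (λ y → count (λ x → R? x y) xs) ys)
    sum-count-swap [] ys = sym (sum-zeros ys)
      where
      sum-zeros : ∀ ys → sum (map (λ _ → 0) ys) ≡ 0
      sum-zeros [] = refl
      sum-zeros (_ ∷ ys) = sum-zeros ys
    sum-count-swap (x ∷ xs) ys = trans (cong (count (R? x) ys +_) (sum-count-swap xs ys)) (sym (sum-count-∷ ys))
      where
      column : B → ℕ
      column y = count (λ x′ → R? x′ y) xs
      sum-count-∷ : ∀ ys → sum (map (λ y → count (λ x′ → R? x′ y) (x ∷ xs)) ys)
                         ≡ count (R? x) ys + sum (map column ys)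
      sum-count-∷ [] = refl
      sum-count-∷ (y ∷ ys) with R? x y
      ... | yes _ = cong suc (trans (cong (column y +_) (sum-count-∷ ys)) (x∙yz≈y∙xz (column y) (count (R? x) ys) _))
      ... | no _ = trans (cong (column y +_) (sum-count-∷ ys)) (x∙yz≈y∙xz (column y) (count (R? x) ys) _)

  length-≤-injection : {A B : Set} (f : A → B) {xs : List A} {ys : List B} → Unique xs →
    (∀ {x y} → x ∈ xs → y ∈ xs → f x ≡ f y → x ≡ y) → (∀ {x} → x ∈ xs → f x ∈ ys) →
    length xs ≤ length ys
  length-≤-injection f [] injective into = z≤n
  length-≤-injection f {x ∷ xs} (x∉xs ∷ unique) injective into with ∈-∃++ (into (here refl))
  ... | ws₁ , ws₂ , refl = ≤-trans (s≤s rest) (≤-reflexive (sym (trans (length-++ ws₁) (+-suc _ _))))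
    where
    remove : ∀ ws {z} → z ∈ ws ++ f x ∷ ws₂ → z ≢ f x → z ∈ ws ++ ws₂
    remove [] (here refl) z≢fx = ⊥-elim (z≢fx refl)
    remove [] (there z∈) _ = z∈
    remove (w ∷ ws) (here refl) _ = here refl
    remove (w ∷ ws) (there z∈) z≢fx = there (remove ws z∈ z≢fx)
    rest : length xs ≤ length ws₁ + length ws₂
    rest = ≤-trans
      (length-≤-injection f unique (λ p q → injective (there p) (there q)) λ y∈xs →
        remove ws₁ (into (there y∈xs)) λ fy≡fx →
          All.lookup x∉xs y∈xs (sym (injective (there y∈xs) (here refl) fy≡fx)))
      (≤-reflexive (length-++ ws₁))

  module _ {A : Set} {P Q : A → Set} (P? : Decidable P) (Q? : Decidable Q) where

    count-≐ : P ≐ Q → ∀ xs → count P? xs ≡ count Q? xs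
    count-≐ P≐Q = cong length ∘ filter-≐ P? Q? P≐Q

    count-≤-injection : (f g : A → A) {xs : List A} → Unique xs → (∀ x → x ∈ xs) →
      (∀ {x} → P x → Q (f x)) → (∀ {x} → P x → g (f x) ≡ x) → count P? xs ≤ count Q? xs
    count-≤-injection f g {xs} unique complete P⇒Q g∘f≡id = length-≤-injection f (Unique.filter⁺ P? unique)
      (λ p q fx≡fy → trans (sym (g∘f≡id (satisfies p))) (trans (cong g fx≡fy) (g∘f≡id (satisfies q))))
      (λ p → ∈-filter⁺ Q? (complete _) (P⇒Q (satisfies p)))
      where
      satisfies : ∀ {x} → x ∈ filter P? xs → P x
      satisfies = proj₂ ∘ ∈-filter⁻ P? {xs = xs}

module BinomialMoments where

  open Counting
  open import Data.List using (List; []; _∷_; _++_; map; filter)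
  open import Data.List.Extrema.Nat using (max; xs≤max)
  open import Data.List.Properties using (filter-accept; filter-reject)
  open import Data.List.Relation.Unary.All as All using (All; []; _∷_)
  import Data.List.Relation.Unary.All.Properties as All
  open import Data.Nat using (ℕ; zero; suc; _+_; _*_; _<_; _≟_; s≤s)
  open import Data.Nat.Combinatorics using (_C_; nCn≡1; k>n⇒nCk≡0)
  open import Data.Nat.ListAction using (sum)
  open import Data.Nat.Properties
    using (+-assoc; +-identityʳ; *-identityʳ; +-cancelˡ-≡; ≤∧≢⇒<; ≤-pred; +-commutativeSemigroup)
  open import Algebra.Properties.CommutativeSemigroup +-commutativeSemigroup using (x∙yz≈y∙xz)
  open import Data.Product using (_,_)
  open import Function using (_∘_)
  open import Relation.Binary.PropositionalEquality using (_≡_; _≢_; refl; sym; trans; cong; cong₂; module ≡-Reasoning)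
  open import Relation.Nullary using (Dec; yes; no; ¬?)

  moment : ℕ → List ℕ → ℕ
  moment s xs = sum (map (_C s) xs)

  sum-map-split : (f : ℕ → ℕ) (M : ℕ) (xs : List ℕ) →
    sum (map f xs) ≡ count (_≟ M) xs * f M + sum (map f (filter (¬? ∘ (_≟ M)) xs))
  sum-map-split f M [] = refl
  sum-map-split f M (x ∷ xs) with x ≟ M
  ... | yes refl
    rewrite count-accept (_≟ x) {xs = xs} refl | filter-reject (¬? ∘ (_≟ x)) {xs = xs} (λ x≢x → x≢x refl)
    = trans (cong (f x +_) (sum-map-split f x xs)) (sym (+-assoc (f x) _ _))
  ... | no x≢M
    rewrite count-reject (_≟ M) {xs = xs} x≢M | filter-accept (¬? ∘ (_≟ M)) {xs = xs} x≢M
    = trans (cong (f x +_) (sum-map-split f M xs)) (x∙yz≈y∙xz (f x) (count (_≟ M) xs * f M) _)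

  moment-below≡0 : ∀ {M xs} → All (_< M) xs → moment M xs ≡ 0
  moment-below≡0 [] = refl
  moment-below≡0 (x<M ∷ xs<M) rewrite k>n⇒nCk≡0 x<M = moment-below≡0 xs<M

  filter-≢-top : ∀ {M xs} → All (_< suc M) xs → All (_< M) (filter (¬? ∘ (_≟ M)) xs)
  filter-≢-top {M} {xs} xs≤M = All.zipWith (λ (x≤M , x≢M) → ≤∧≢⇒< (≤-pred x≤M) x≢M)
    (All.filter⁺ (¬? ∘ (_≟ M)) xs≤M , All.all-filter (¬? ∘ (_≟ M)) xs)

  moment-top : ∀ {M xs} → All (_< suc M) xs → moment M xs ≡ count (_≟ M) xs
  moment-top {M} {xs} xs≤M = begin
    moment M xs
      ≡⟨ sum-map-split (_C M) M xs ⟩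
    count (_≟ M) xs * (M C M) + moment M (filter (¬? ∘ (_≟ M)) xs)
      ≡⟨ cong₂ _+_ (cong (count (_≟ M) xs *_) (nCn≡1 M)) (moment-below≡0 (filter-≢-top xs≤M)) ⟩
    count (_≟ M) xs * 1 + 0
      ≡⟨ trans (+-identityʳ _) (*-identityʳ _) ⟩
    count (_≟ M) xs ∎
    where open ≡-Reasoning

  -- Below a bound suc M, the M-th moment counts the entries equal to M; discarding those entries
  -- leaves lists below M whose moments still agree.
  multiplicities-from-bounded-moments : ∀ B {xs ys} → All (_< B) xs → All (_< B) ys →
    (∀ s → moment s xs ≡ moment s ys) → ∀ r → count (_≟ r) xs ≡ count (_≟ r) ys
  multiplicities-from-bounded-moments zero [] [] _ _ = refl
  multiplicities-from-bounded-moments (suc M) {xs} {ys} xs<B ys<B same r = by-cases (r ≟ M)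
    where
    open ≡-Reasoning

    remove-top : List ℕ → List ℕ
    remove-top = filter (¬? ∘ (_≟ M))

    top : count (_≟ M) xs ≡ count (_≟ M) ys
    top = trans (sym (moment-top xs<B)) (trans (same M) (moment-top ys<B))

    same-below : ∀ s → moment s (remove-top xs) ≡ moment s (remove-top ys)
    same-below s = +-cancelˡ-≡ (count (_≟ M) xs * (M C s)) _ _ (begin
      count (_≟ M) xs * (M C s) + moment s (remove-top xs) ≡⟨ sum-map-split (_C s) M xs ⟨
      moment s xs                                          ≡⟨ same s ⟩
      moment s ys                                          ≡⟨ sum-map-split (_C s) M ys ⟩
      count (_≟ M) ys * (M C s) + moment s (remove-top ys) ≡⟨ cong (λ c → c * (M C s) + _) top ⟨
      count (_≟ M) xs * (M C s) + moment s (remove-top ys) ∎)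

    below-M-xs : All (_< M) (remove-top xs)
    below-M-xs = filter-≢-top xs<B

    below-M-ys : All (_< M) (remove-top ys)
    below-M-ys = filter-≢-top ys<B

    ≡r⇒≢M : ∀ {x} → r ≢ M → x ≡ r → x ≢ M
    ≡r⇒≢M r≢M refl = r≢M

    by-cases : Dec (r ≡ M) → count (_≟ r) xs ≡ count (_≟ r) ys
    by-cases (yes refl) = top
    by-cases (no r≢M) = begin
      count (_≟ r) xs              ≡⟨ count-filter-⊆ (_≟ r) (¬? ∘ (_≟ M)) (≡r⇒≢M r≢M) xs ⟨
      count (_≟ r) (remove-top xs) ≡⟨ multiplicities-from-bounded-moments M below-M-xs below-M-ys same-below r ⟩
      count (_≟ r) (remove-top ys) ≡⟨ count-filter-⊆ (_≟ r) (¬? ∘ (_≟ M)) (≡r⇒≢M r≢M) ys ⟩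
      count (_≟ r) ys              ∎

  multiplicities-from-moments : ∀ xs ys → (∀ s → moment s xs ≡ moment s ys) →
    ∀ r → count (_≟ r) xs ≡ count (_≟ r) ys
  multiplicities-from-moments xs ys = multiplicities-from-bounded-moments (suc (max 0 (xs ++ ys)))
    (All.++⁻ˡ xs below) (All.++⁻ʳ xs below)
    where
    below : All (_< suc (max 0 (xs ++ ys))) (xs ++ ys)
    below = All.map s≤s (xs≤max 0 (xs ++ ys))

module Subsets where

  open Counting
  open BinomialMoments using (moment)
  open import Data.Fin using (Fin; zero; suc; toℕ)
  open import Data.Fin.Properties using (all?)
  open import Data.Fin.Subset using (Subset; inside; outside; Lift)
  open import Data.Fin.Subset.Properties using (_∈?_)
  open import Data.List using (List; []; _∷_; [_]; _++_; map; upTo; applyUpTo)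
  open import Data.List.Properties using (map-upTo; map-∘; map-cong)
  open import Data.Nat using (ℕ; zero; suc; _+_)
  open import Data.Nat.Combinatorics using (_C_; nCk+nC[k+1]≡[n+1]C[k+1])
  open import Data.Nat.ListAction using (sum)
  open import Data.Product using (_,_)
  open import Data.Vec using ([]; _∷_; here; there)
  open import Function using (_∘_)
  open import Relation.Binary.PropositionalEquality using (_≡_; refl; sym; trans; cong; cong₂; module ≡-Reasoning)
  open import Relation.Nullary using (¬_; Dec; yes; no)
  open import Relation.Nullary.Decidable using (map′; _→-dec_)
  open import Relation.Unary using (Decidable; _≐_)

  lift? : ∀ {n} {O : Fin n → Set} → Decidable O → Decidable (Lift O)
  lift? O? S = map′ (λ O[S] {x} → O[S] x) (λ O[S] x → O[S] {x}) (all? λ x → x ∈? S →-dec O? x)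

  subsetsOfSize : (n s : ℕ) → List (Subset n)
  subsetsOfSize zero zero = [ [] ]
  subsetsOfSize zero (suc s) = []
  subsetsOfSize (suc n) zero = map (outside ∷_) (subsetsOfSize n zero)
  subsetsOfSize (suc n) (suc s) = map (inside ∷_) (subsetsOfSize n s) ++ map (outside ∷_) (subsetsOfSize n (suc s))

  module _ {n} {O : Fin (suc n) → Set} where

    Lift-outside : (λ S → Lift O (outside ∷ S)) ≐ Lift (O ∘ suc)
    Lift-outside = (λ O[S] x∈S → O[S] (there x∈S)) , λ { O[S] (there x∈S) → O[S] x∈S }

    Lift-inside : O zero → (λ S → Lift O (inside ∷ S)) ≐ Lift (O ∘ suc)
    Lift-inside O₀ = (λ O[S] x∈S → O[S] (there x∈S)) , λ { O[S] here → O₀ ; O[S] (there x∈S) → O[S] x∈S }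

  module _ {O : ℕ → Set} (O? : Decidable O) (n : ℕ) where

    count-applyUpTo-suc : count O? (applyUpTo suc n) ≡ count (O? ∘ suc) (upTo n)
    count-applyUpTo-suc = trans (cong (count O?) (sym (map-upTo suc n))) (count-map O? suc (upTo n))

    count-upTo-suc-accept : O 0 → count O? (upTo (suc n)) ≡ suc (count (O? ∘ suc) (upTo n))
    count-upTo-suc-accept O₀ = trans (count-accept O? O₀) (cong suc count-applyUpTo-suc)

    count-upTo-suc-reject : ¬ O 0 → count O? (upTo (suc n)) ≡ count (O? ∘ suc) (upTo n)
    count-upTo-suc-reject ¬O₀ = trans (count-reject O? ¬O₀) count-applyUpTo-suc

  module _ {n} {O : ℕ → Set} (O? : Decidable O) (Ss : List (Subset n)) where

    count-outside : count (lift? (O? ∘ toℕ)) (map (outside ∷_) Ss) ≡ count (lift? (O? ∘ suc ∘ toℕ)) Ss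
    count-outside = trans (count-map (lift? (O? ∘ toℕ)) (outside ∷_) Ss)
                          (count-≐ _ (lift? (O? ∘ suc ∘ toℕ)) (Lift-outside {n} {O ∘ toℕ}) Ss)

    count-inside : O 0 → count (lift? (O? ∘ toℕ)) (map (inside ∷_) Ss) ≡ count (lift? (O? ∘ suc ∘ toℕ)) Ss
    count-inside O₀ = trans (count-map (lift? (O? ∘ toℕ)) (inside ∷_) Ss)
                            (count-≐ _ (lift? (O? ∘ suc ∘ toℕ)) (Lift-inside {n} {O ∘ toℕ} O₀) Ss)

    count-inside-none : ¬ O 0 → count (lift? (O? ∘ toℕ)) (map (inside ∷_) Ss) ≡ 0
    count-inside-none ¬O₀ = trans (count-map (lift? (O? ∘ toℕ)) (inside ∷_) Ss)
                                  (count-none (lift? (O? ∘ toℕ) ∘ (inside ∷_)) (λ O[S] → ¬O₀ (O[S] here)) Ss)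

  count-subsetsOfSize : ∀ n s {O : ℕ → Set} (O? : Decidable O) →
    count (lift? (O? ∘ toℕ)) (subsetsOfSize n s) ≡ count O? (upTo n) C s
  count-subsetsOfSize zero zero O? = refl
  count-subsetsOfSize zero (suc s) O? = refl
  count-subsetsOfSize (suc n) zero O? =
    trans (count-outside O? (subsetsOfSize n zero)) (count-subsetsOfSize n zero (O? ∘ suc))
  count-subsetsOfSize (suc n) (suc s) {O} O? = begin
    lifted (map (inside ∷_) Ss ++ map (outside ∷_) Ss′)
      ≡⟨ count-++ (lift? (O? ∘ toℕ)) (map (inside ∷_) Ss) (map (outside ∷_) Ss′) ⟩
    lifted (map (inside ∷_) Ss) + lifted (map (outside ∷_) Ss′)
      ≡⟨ cong (lifted (map (inside ∷_) Ss) +_) (trans (count-outside O? Ss′) (count-subsetsOfSize n (suc s) (O? ∘ suc))) ⟩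
    lifted (map (inside ∷_) Ss) + c C suc s
      ≡⟨ split-first-position (O? 0) ⟩
    count O? (upTo (suc n)) C suc s ∎
    where
    open ≡-Reasoning
    Ss Ss′ : List (Subset n)
    Ss = subsetsOfSize n s
    Ss′ = subsetsOfSize n (suc s)
    lifted : List (Subset (suc n)) → ℕ
    lifted = count (lift? (O? ∘ toℕ))
    c : ℕ
    c = count (O? ∘ suc) (upTo n)
    split-first-position : Dec (O 0) → lifted (map (inside ∷_) Ss) + c C suc s ≡ count O? (upTo (suc n)) C suc s
    split-first-position (yes O₀) = begin
      lifted (map (inside ∷_) Ss) + c C suc s
        ≡⟨ cong (_+ c C suc s) (trans (count-inside O? Ss O₀) (count-subsetsOfSize n s (O? ∘ suc))) ⟩
      c C s + c C suc s
        ≡⟨ nCk+nC[k+1]≡[n+1]C[k+1] c s ⟩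
      suc c C suc s
        ≡⟨ cong (_C suc s) (count-upTo-suc-accept O? n O₀) ⟨
      count O? (upTo (suc n)) C suc s ∎
    split-first-position (no ¬O₀) =
      cong₂ _+_ (count-inside-none O? Ss ¬O₀) (cong (_C suc s) (sym (count-upTo-suc-reject O? n ¬O₀)))

  moment-as-subset-sum : ∀ {A : Set} {O : A → ℕ → Set} (O? : ∀ x → Decidable (O x)) n s (xs : List A) →
    moment s (map (λ x → count (O? x) (upTo n)) xs)
    ≡ sum (map (λ S → count (λ x → lift? (O? x ∘ toℕ) S) xs) (subsetsOfSize n s))
  moment-as-subset-sum O? n s xs = begin
    sum (map (_C s) (map (λ x → count (O? x) (upTo n)) xs))
      ≡⟨ cong sum (map-∘ xs) ⟨
    sum (map (λ x → count (O? x) (upTo n) C s) xs)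
      ≡⟨ cong sum (map-cong (λ x → sym (count-subsetsOfSize n s (O? x))) xs) ⟩
    sum (map (λ x → count (lift? (O? x ∘ toℕ)) (subsetsOfSize n s)) xs)
      ≡⟨ sum-count-swap (λ x → lift? (O? x ∘ toℕ)) xs (subsetsOfSize n s) ⟩
    sum (map (λ S → count (λ x → lift? (O? x ∘ toℕ) S) xs) (subsetsOfSize n s)) ∎
    where open ≡-Reasoning

module Words where

  open import Data.Fin using (Fin)
  open import Data.List using (map)
  open import Data.List.Membership.Propositional using (_∈_)
  open import Data.List.Membership.Propositional.Properties using (∈-map⁺; ∈-map⁻; ∈-concat⁺′; ∈-allFin)
  open import Data.List.Relation.Unary.All as All using ([])
  import Data.List.Relation.Unary.All.Properties as All
  open import Data.List.Relation.Unary.AllPairs as AllPairs using ([]; _∷_)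
  import Data.List.Relation.Unary.AllPairs.Properties as AllPairs
  open import Data.List.Relation.Unary.Any using (here)
  open import Data.List.Relation.Unary.Unique.Propositional using (Unique)
  import Data.List.Relation.Unary.Unique.Propositional.Properties as Unique
  open import Data.Nat using (zero; suc)
  open import Data.Product using (_×_; _,_)
  open import Data.Vec using (Vec; []; _∷_)
  open import Data.Vec.Properties using (∷-injectiveˡ; ∷-injectiveʳ)
  open import Relation.Binary.PropositionalEquality using (_≢_; refl)
  open import Relation.Nullary using (¬_)

  allVecs-complete : ∀ k n (v : Vec (Fin k) n) → v ∈ allVecs k n
  allVecs-complete k zero [] = here refl
  allVecs-complete k (suc n) (x ∷ v) =
    ∈-concat⁺′ (∈-map⁺ (x ∷_) (allVecs-complete k n v))
               (∈-map⁺ (λ y → map (y ∷_) (allVecs k n)) (∈-allFin x))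

  allVecs-unique : ∀ k n → Unique (allVecs k n)
  allVecs-unique k zero = [] ∷ []
  allVecs-unique k (suc n) =
    Unique.concat⁺ (All.map⁺ (All.tabulate λ _ → Unique.map⁺ ∷-injectiveʳ (allVecs-unique k n)))
                   (AllPairs.map⁺ (AllPairs.map disjoint (Unique.allFin⁺ k)))
    where
    disjoint : ∀ {x y : Fin k} → x ≢ y →
      ∀ {v} → ¬ (v ∈ map (x ∷_) (allVecs k n) × v ∈ map (y ∷_) (allVecs k n))
    disjoint x≢y (p , q) with ∈-map⁻ _ p | ∈-map⁻ _ q
    ... | _ , _ , refl | _ , _ , x∷v≡y∷w = x≢y (∷-injectiveˡ x∷v≡y∷w)

module Windows where

  open import Data.Empty using (⊥-elim)
  open import Data.Fin using (Fin; zero; suc; toℕ; fromℕ)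
  open import Data.Fin.Properties using (toℕ-injective; toℕ-fromℕ<; toℕ-fromℕ; toℕ<n; toℕ≤pred[n]; any?)
  open import Data.Fin.Subset using (Subset; _∈_)
  open import Data.Fin.Subset.Properties using (_∈?_)
  open import Data.Nat as ℕ using (ℕ; suc; _+_; _≤_; _<_; s≤s; z≤n)
  open import Data.Nat.Properties
    using (m≤m+n; m<m+n; +-monoʳ-≤; +-monoʳ-<; <-irrefl; +-cancelˡ-≡; ≤-antisym; ≮⇒≥; module ≤-Reasoning)
  open import Data.Product using (∃₂; _×_; _,_; proj₂)
  open import Data.Sum using (_⊎_; inj₁; inj₂)
  open import Relation.Binary using (tri<; tri≈; tri>)
  open import Relation.Binary.PropositionalEquality using (_≡_; refl; sym; trans; subst)
  open import Relation.Nullary using (¬_; Dec; yes; no; _×-dec_)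

  toℕ-pos : ∀ {n l} i (h : i + l ≤ n) (t : Fin l) → toℕ (pos i h t) ≡ i + toℕ t
  toℕ-pos i h t = toℕ-fromℕ< _

  Interior : ∀ {l} → Fin (suc l) → Set
  Interior {l} t = 0 < toℕ t × toℕ t < l

  interior? : ∀ {l} (t : Fin (suc l)) → Dec (Interior t)
  interior? {l} t = (0 ℕ.<? toℕ t) ×-dec (toℕ t ℕ.<? l)

  ¬interior⇒endpoint : ∀ {l} {t : Fin (suc l)} → ¬ Interior t → t ≡ zero ⊎ t ≡ fromℕ l
  ¬interior⇒endpoint {t = zero} _ = inj₁ refl
  ¬interior⇒endpoint {l} {t = suc t} ¬interior = inj₂ (toℕ-injective (trans
    (≤-antisym (toℕ<n t) (≮⇒≥ λ t<l → ¬interior (s≤s z≤n , t<l))) (sym (toℕ-fromℕ l))))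

  module Covering {n : ℕ} (l : ℕ) (S : Subset n) where

    Covers : Fin n → Fin (suc l) → Fin n → Set
    Covers j t p = j ∈ S × Interior t × (toℕ j + suc l ≤ n) × (toℕ j + toℕ t ≡ toℕ p)

    Spaced : Set
    Spaced = ∀ {i j} → i ∈ S → j ∈ S → toℕ i < toℕ j → toℕ i + l ≤ toℕ j

    cover-unique : Spaced → ∀ {i j u t p} → Covers i u p → j ∈ S → toℕ j + toℕ t ≡ toℕ p →
      i ≡ j × u ≡ t
    cover-unique spaced {i} {j} {u} {t} {p} (i∈S , (0<u , u<l) , _ , i+u≡p) j∈S j+t≡p
      with ℕ.<-cmp (toℕ i) (toℕ j)
    ... | tri< i<j _ _ = ⊥-elim (<-irrefl refl (begin-strict
      toℕ p           ≡⟨ sym i+u≡p ⟩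
      toℕ i + toℕ u   <⟨ +-monoʳ-< (toℕ i) u<l ⟩
      toℕ i + l       ≤⟨ spaced i∈S j∈S i<j ⟩
      toℕ j           ≤⟨ m≤m+n (toℕ j) (toℕ t) ⟩
      toℕ j + toℕ t   ≡⟨ j+t≡p ⟩
      toℕ p           ∎))
      where open ≤-Reasoning
    ... | tri> _ _ j<i = ⊥-elim (<-irrefl refl (begin-strict
      toℕ p           ≡⟨ sym j+t≡p ⟩
      toℕ j + toℕ t   ≤⟨ +-monoʳ-≤ (toℕ j) (toℕ≤pred[n] t) ⟩
      toℕ j + l       ≤⟨ spaced j∈S i∈S j<i ⟩
      toℕ i           <⟨ m<m+n (toℕ i) 0<u ⟩
      toℕ i + toℕ u   ≡⟨ i+u≡p ⟩
      toℕ p           ∎))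
      where open ≤-Reasoning
    ... | tri≈ _ i≡j _ with refl ← toℕ-injective i≡j =
      refl , toℕ-injective (+-cancelˡ-≡ (toℕ i) _ _ (trans i+u≡p (sym j+t≡p)))

    covered? : ∀ p → Dec (∃₂ λ j t → Covers j t p)
    covered? p = any? λ j → any? λ t →
      (j ∈? S) ×-dec interior? t ×-dec (toℕ j + suc l ℕ.≤? n) ×-dec (toℕ j + toℕ t ℕ.≟ toℕ p)

    relocate-at : (Fin (suc l) → Fin (suc l)) → (p : Fin n) → Dec (∃₂ λ j t → Covers j t p) → Fin n
    relocate-at G p (yes (j , t , _ , _ , j+l<n , _)) = pos (toℕ j) j+l<n (G t)
    relocate-at G p (no _) = p

    relocate : (Fin (suc l) → Fin (suc l)) → Fin n → Fin n
    relocate G p = relocate-at G p (covered? p)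

    module _ (spaced : Spaced) (G : Fin (suc l) → Fin (suc l)) where

      relocate-covered : ∀ {j t p} → Covers j t p → toℕ (relocate G p) ≡ toℕ j + toℕ (G t)
      relocate-covered {j} {t} {p} cover@(j∈S , _ , _ , j+t≡p) with covered? p
      ... | no uncovered = ⊥-elim (uncovered (j , t , cover))
      ... | yes (i , u , cover′@(_ , _ , i+l≤n , _)) with refl , refl ← cover-unique spaced cover′ j∈S j+t≡p =
        toℕ-pos (toℕ i) i+l≤n (G u)

      relocate-uncovered : ∀ {p} → ¬ (∃₂ λ j t → Covers j t p) → relocate G p ≡ p
      relocate-uncovered {p} uncovered with covered? p
      ... | yes cover = ⊥-elim (uncovered cover)
      ... | no _ = refl

      relocate-interior : ∀ {j t} → j ∈ S → (h : toℕ j + suc l ≤ n) → Interior t →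
        relocate G (pos (toℕ j) h t) ≡ pos (toℕ j) h (G t)
      relocate-interior {j} {t} j∈S h interior = toℕ-injective (trans
        (relocate-covered (j∈S , interior , h , sym (toℕ-pos (toℕ j) h t)))
        (sym (toℕ-pos (toℕ j) h (G t))))

      relocate-endpoint : ∀ {j t} → j ∈ S → (h : toℕ j + suc l ≤ n) → ¬ Interior t →
        relocate G (pos (toℕ j) h t) ≡ pos (toℕ j) h t
      relocate-endpoint {j} {t} j∈S h endpoint = relocate-uncovered λ (i , u , cover@(_ , interior , _)) →
        endpoint (subst Interior (proj₂ (cover-unique spaced cover j∈S (sym (toℕ-pos (toℕ j) h t)))) interior)

module Relabelling where

  open Windows
  open Subsets using (lift?)
  open import Data.Fin using (Fin; toℕ)
  open import Data.Fin.Properties using (toℕ-injective)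
  open import Data.Fin.Subset using (Subset; _∈_; Lift)
  open import Data.Nat using (suc; _+_; _≤_)
  open import Data.Nat.Properties using (+-suc; +-comm; ≤-pred)
  open import Data.Product using (∃₂; _,_; proj₂)
  open import Function using (id; _∘_)
  open import Function.Bundles using (Equivalence)
  open import Relation.Binary.PropositionalEquality using (_≡_; _≗_; refl; sym; trans; cong; subst₂; module ≡-Reasoning)
  open import Relation.Nullary using (¬_; Dec; yes; no)
  open import Relation.Unary using (Decidable)

  OrderIso-reindex : ∀ {k m l l′} {u : Fin l → Fin k} {ρ : Fin l → Fin m}
    {w : Fin l′ → Fin k} {ρ′ : Fin l′ → Fin m} (G : Fin l′ → Fin l) →
    (∀ t → w t ≡ u (G t)) → (∀ t → ρ′ t ≡ ρ (G t)) → OrderIso u ρ → OrderIso w ρ′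
  OrderIso-reindex G w≡u∘G ρ′≡ρ∘G iso p q
    rewrite w≡u∘G p | w≡u∘G q | ρ′≡ρ∘G p | ρ′≡ρ∘G q = iso (G p) (G q)

  OrderIso-≡ : ∀ {k m l} {u : Fin l → Fin k} {ρ : Fin l → Fin m} → OrderIso u ρ →
    ∀ p q → ρ p ≡ ρ q → u p ≡ u q
  OrderIso-≡ iso p q = Equivalence.from (proj₂ (iso p q))

  occursAt-cong : ∀ {k n m l} {σ σ′ : Word k n} {τ : Fin l → Fin m} {i} →
    σ ≗ σ′ → OccursAt σ τ i → OccursAt σ′ τ i
  occursAt-cong σ≗σ′ (h , iso) = h , OrderIso-reindex id (sym ∘ σ≗σ′ ∘ _) (λ _ → refl) iso

  AllOccur : ∀ {k n m l} → Word k n → (Fin l → Fin m) → Subset n → Set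
  AllOccur σ τ S = Lift (λ j → OccursAt σ τ (toℕ j)) S

  allOccur? : ∀ {k n m l} (σ : Word k n) (τ : Fin l → Fin m) → Decidable (AllOccur σ τ)
  allOccur? σ τ = lift? (occursAt? σ τ ∘ toℕ)

  module _ {k n m l} {σ : Word k n} {τ : Fin (suc l) → Fin m} {S : Subset n} (σ-occurs : AllOccur σ τ S) where
    open Covering l S

    primitive⇒spaced : Primitive τ → Spaced
    primitive⇒spaced prim {i} {j} i∈S j∈S i<j = ≤-pred (subst₂ _≤_ (+-suc (toℕ i) l) (+-comm (toℕ j) 1)
      (prim k n σ (toℕ i) (toℕ j) (σ-occurs i∈S) (σ-occurs j∈S) i<j))

    module _ (spaced : Spaced) (G : Fin (suc l) → Fin (suc l))
             (endpoints : ∀ t → ¬ Interior t → τ (G t) ≡ τ t) where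

      -- pos ignores its bound proof (fromℕ< takes it irrelevantly), so the occurrence at j
      -- provided by σ-occurs applies to pos (toℕ j) h for any h.
      relabel-window : ∀ {j} → j ∈ S → (h : toℕ j + suc l ≤ n) → ∀ t →
        σ (relocate G (pos (toℕ j) h t)) ≡ σ (pos (toℕ j) h (G t))
      relabel-window j∈S h t with interior? t
      ... | yes interior = cong σ (relocate-interior spaced G j∈S h interior)
      ... | no endpoint = trans (cong σ (relocate-endpoint spaced G j∈S h endpoint))
                                (OrderIso-≡ (proj₂ (σ-occurs j∈S)) t (G t) (sym (endpoints t endpoint)))

      relabel-occurs : {τ′ : Fin (suc l) → Fin m} → (∀ t → τ (G t) ≡ τ′ t) → AllOccur (σ ∘ relocate G) τ′ S
      relabel-occurs τ∘G≡τ′ j∈S with h , iso ← σ-occurs j∈S =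
        h , OrderIso-reindex G (relabel-window j∈S h) (sym ∘ τ∘G≡τ′) iso

      relabel-inverse : (G′ : Fin (suc l) → Fin (suc l)) → (∀ t → τ (G (G′ t)) ≡ τ t) →
        ∀ p → σ (relocate G (relocate G′ p)) ≡ σ p
      relabel-inverse G′ τ∘G∘G′≡τ p = by-cover (covered? p)
        where
        by-cover : Dec (∃₂ λ j t → Covers j t p) → σ (relocate G (relocate G′ p)) ≡ σ p
        by-cover (no uncovered) = cong σ (trans (cong (relocate G) (relocate-uncovered spaced G′ uncovered))
                                               (relocate-uncovered spaced G uncovered))
        by-cover (yes (i , u , cover@(i∈S , _ , h , i+u≡p))) = begin
          σ (relocate G (relocate G′ p))
            ≡⟨ cong (σ ∘ relocate G) (toℕ-injective (trans (relocate-covered spaced G′ cover)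
                                                           (sym (toℕ-pos (toℕ i) h (G′ u))))) ⟩
          σ (relocate G (pos (toℕ i) h (G′ u)))
            ≡⟨ relabel-window i∈S h (G′ u) ⟩
          σ (pos (toℕ i) h (G (G′ u)))
            ≡⟨ OrderIso-≡ (proj₂ (σ-occurs i∈S)) _ u (τ∘G∘G′≡τ u) ⟩
          σ (pos (toℕ i) h u)
            ≡⟨ cong σ (toℕ-injective (trans (toℕ-pos (toℕ i) h u) i+u≡p)) ⟩
          σ p ∎
          where open ≡-Reasoning

open Counting using (count; count-map; count-≤-injection)
open BinomialMoments using (moment; multiplicities-from-moments)
open Subsets using (subsetsOfSize; moment-as-subset-sum)
open Words using (allVecs-complete; allVecs-unique)
open Windows using (Interior; ¬interior⇒endpoint; module Covering)
open Relabelling using (AllOccur; allOccur?; occursAt-cong; primitive⇒spaced; relabel-occurs; relabel-inverse)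

open import Data.Fin using (Fin; zero; fromℕ; _<_)
open import Data.Fin.Subset using (Subset)
open import Data.List using (List; map)
open import Data.List.Properties using (map-cong)
open import Data.Nat using (ℕ; suc; _≥_; _≤_; _≟_)
open import Data.Nat.ListAction using (sum)
open import Data.Nat.Properties using (≤-antisym)
open import Data.Product using (proj₁; proj₂)
open import Data.Sum using (inj₁; inj₂)
open import Data.Vec using (Vec; lookup; tabulate)
open import Data.Vec.Properties using (lookup∘tabulate; tabulate∘lookup; tabulate-cong)
open import Function using (_∘_)
open import Relation.Binary.PropositionalEquality using (_≡_; refl; sym; trans; cong; module ≡-Reasoning)
open import Relation.Nullary using (¬_)

module _ {k n m l : ℕ} {τ τ′ : Fin (suc l) → Fin m} (g g′ : Fin (suc l) → Fin (suc l))
  (τ∘g≡τ′ : ∀ t → τ (g t) ≡ τ′ t) (τ′∘g′≡τ : ∀ t → τ′ (g′ t) ≡ τ t)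
  (endpoints : ∀ t → ¬ Interior t → τ′ t ≡ τ t) (τ-primitive : Primitive τ) (S : Subset n) where

  open Covering l S using (Spaced; relocate)

  relabel : (Fin (suc l) → Fin (suc l)) → Vec (Fin k) n → Vec (Fin k) n
  relabel G v = tabulate (lookup v ∘ relocate G)

  private
    spaced : ∀ {v : Vec (Fin k) n} → AllOccur (lookup v) τ S → Spaced
    spaced {v} occurs = primitive⇒spaced {σ = lookup v} occurs τ-primitive

    g-endpoints : ∀ t → ¬ Interior t → τ (g t) ≡ τ t
    g-endpoints t endpoint = trans (τ∘g≡τ′ t) (endpoints t endpoint)

  relabel-AllOccur : ∀ {v} → AllOccur (lookup v) τ S → AllOccur (lookup (relabel g v)) τ′ S
  relabel-AllOccur {v} occurs j∈S = occursAt-cong (sym ∘ lookup∘tabulate _)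
    (relabel-occurs {σ = lookup v} occurs (spaced {v} occurs) g g-endpoints τ∘g≡τ′ j∈S)

  relabel-relabel : ∀ {v} → AllOccur (lookup v) τ S → relabel g′ (relabel g v) ≡ v
  relabel-relabel {v} occurs = trans
    (tabulate-cong λ p → trans (lookup∘tabulate _ (relocate g′ p))
      (relabel-inverse {σ = lookup v} occurs (spaced {v} occurs) g g-endpoints g′ τ∘g∘g′≡τ p))
    (tabulate∘lookup v)
    where
    τ∘g∘g′≡τ : ∀ t → τ (g (g′ t)) ≡ τ t
    τ∘g∘g′≡τ t = trans (τ∘g≡τ′ (g′ t)) (τ′∘g′≡τ t)

  count-AllOccur-≤ : count (λ v → allOccur? (lookup v) τ S) (allVecs k n)
                   ≤ count (λ v → allOccur? (lookup v) τ′ S) (allVecs k n)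
  count-AllOccur-≤ = count-≤-injection _ _ (relabel g) (relabel g′) (allVecs-unique k n) (allVecs-complete k n)
    (λ {v} → relabel-AllOccur {v}) (λ {v} → relabel-relabel {v})

module _ {m l : ℕ} {τ τ′ : Fin (suc l) → Fin m} (g g′ : Fin (suc l) → Fin (suc l))
  (τ∘g≡τ′ : ∀ t → τ (g t) ≡ τ′ t) (τ′∘g′≡τ : ∀ t → τ′ (g′ t) ≡ τ t)
  (endpoints : ∀ t → ¬ Interior t → τ′ t ≡ τ t) (τ-primitive : Primitive τ) (τ′-primitive : Primitive τ′) where

  reindexing⇒countExactly-≡ : ∀ k n r → countExactly k n τ r ≡ countExactly k n τ′ r
  reindexing⇒countExactly-≡ k n r = begin
    countExactly k n τ r
      ≡⟨ count-map (_≟ r) (occurrences-in τ) (allVecs k n) ⟨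
    count (_≟ r) (occurrence-counts τ)
      ≡⟨ multiplicities-from-moments (occurrence-counts τ) (occurrence-counts τ′) same-moments r ⟩
    count (_≟ r) (occurrence-counts τ′)
      ≡⟨ count-map (_≟ r) (occurrences-in τ′) (allVecs k n) ⟩
    countExactly k n τ′ r ∎
    where
    open ≡-Reasoning
    occurrences-in : (Fin (suc l) → Fin m) → Vec (Fin k) n → ℕ
    occurrences-in ρ v = occurrences (lookup v) ρ
    occurrence-counts : (Fin (suc l) → Fin m) → List ℕ
    occurrence-counts ρ = map (occurrences-in ρ) (allVecs k n)
    same-moments : ∀ s → moment s (occurrence-counts τ) ≡ moment s (occurrence-counts τ′)
    same-moments s = begin
      moment s (occurrence-counts τ)
        ≡⟨ moment-as-subset-sum (λ v → occursAt? (lookup v) τ) n s (allVecs k n) ⟩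
      sum (map (λ S → count (λ v → allOccur? (lookup v) τ S) (allVecs k n)) (subsetsOfSize n s))
        ≡⟨ cong sum (map-cong same-count (subsetsOfSize n s)) ⟩
      sum (map (λ S → count (λ v → allOccur? (lookup v) τ′ S) (allVecs k n)) (subsetsOfSize n s))
        ≡⟨ moment-as-subset-sum (λ v → occursAt? (lookup v) τ′) n s (allVecs k n) ⟨
      moment s (occurrence-counts τ′) ∎
      where
      same-count : ∀ S → count (λ v → allOccur? (lookup v) τ S) (allVecs k n)
                       ≡ count (λ v → allOccur? (lookup v) τ′ S) (allVecs k n)
      same-count S = ≤-antisym (count-AllOccur-≤ g g′ τ∘g≡τ′ τ′∘g′≡τ endpoints τ-primitive S)
                               (count-AllOccur-≤ g′ g τ′∘g′≡τ τ∘g≡τ′ (λ t → sym ∘ endpoints t) τ′-primitive S)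

theorem4p3 : (m l : ℕ) (a b : Fin m) → a < b →
    (τ τ′ : Fin (suc l) → Fin m) →
    ContainsAllLetters τ → Primitive τ → τ zero ≡ a → τ (fromℕ l) ≡ b →
    ContainsAllLetters τ′ → Primitive τ′ → τ′ zero ≡ a → τ′ (fromℕ l) ≡ b →
    (k n r : ℕ) → k ≥ 1 →
    countExactly k n τ r ≡ countExactly k n τ′ r
theorem4p3 m l a b _ τ τ′ τ-letters τ-primitive τ₀≡a τₗ≡b τ′-letters τ′-primitive τ′₀≡a τ′ₗ≡b k n r _ =
  reindexing⇒countExactly-≡ (proj₁ ∘ τ-letters ∘ τ′) (proj₁ ∘ τ′-letters ∘ τ)
    (proj₂ ∘ τ-letters ∘ τ′) (proj₂ ∘ τ′-letters ∘ τ) endpoints τ-primitive τ′-primitive k n r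
  where
  endpoints : ∀ t → ¬ Interior t → τ′ t ≡ τ t
  endpoints t endpoint with ¬interior⇒endpoint endpoint
  ... | inj₁ refl = trans τ′₀≡a (sym τ₀≡a)
  ... | inj₂ refl = trans τ′ₗ≡b (sym τₗ≡b)
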